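{- Let $G$ be a connected graph of order $n$ with vertices $g_1,\dots,g_n$ and maximum degree $\Delta(G)$. For $i=1,\dots,n$ let $H_i$ be a connected graph of order $m_i+1$ containing the star $S_{m_i}$ as a subgraph, and let $v_i$ be the center of this star, i.e. $v_i$ is adjacent in $H_i$ to all other $m_i$ vertices of $H_i$. Assume $m_1\ge m_2\ge\dots\ge m_n>\Delta(G)$. Let $G'=G\circ_{v_i}H_i$ be the graph obtained from the disjoint union of $G,H_1,\dots,H_n$ by adding the edges $g_iv_i$, $i=1,\dots,n$. Then Algorithm H2 applied to $G'$ (with any tie-breaking) returns a global dominating set of $G'$ of minimum cardinality.
   Context: All graphs are finite and simple; $V$ denotes the vertex set of the input graph. For a vertex $x$ and $A\subseteq V$: $N(x)$ is the set of neighbors of $x$, $N[x]=N(x)\cup\{x\}$, $N_A(x)=N(x)\cap A$, $N_A[x]=N_A(x)\cup\{x\}$, $\overline{N}(x)$ is the set of vertices other than $x$ not adjacent to $x$, $\overline{N}_A(x)=\overline{N}(x)\cap A$, $\overline{N}_A[x]=\overline{N}_A(x)\cup\{x\}$. For $D\subseteq V$: $N[D]=\bigcup_{x\in D}N[x]$ and $\overline{N}[D]=\bigcup_{x\in D}(\overline{N}(x)\cup\{x\})$ (both empty if $D=\emptyset$). A set $D$ is a dominating set of a graph if every vertex outside $D$ has a neighbor in $D$; $D$ (nonempty) is a global dominating set if it is a dominating set of both the graph and its complement $\overline{G}$ (equivalently, every vertex outside $D$ has both a neighbor and a non-neighbor in $D$). Algorithm H2: start with $D=\emptyset$. While $D$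 is not a global dominating set, perform an iteration: (1) if $D$ is not a dominating set of the graph, choose $v\in V\setminus D$ maximizing $|N_{V\setminus N[D]}[v]|$, and among such maximizers one maximizing $|\overline{N}_{V\setminus\overline{N}[D]}[v]|$ (remaining ties arbitrary), and add $v$ to $D$; (2) then, if $D$ is not a dominating set of the complement, choose $u\in V\setminus D$ maximizing $|\overline{N}_{V\setminus\overline{N}[D]}[u]|$, and among such maximizers one maximizing $|N_{V\setminus N[D]}[u]|$ (remaining ties arbitrary), and add $u$ to $D$. Output $D$ when it is a global dominating set. -}

module Defs where

open import Data.Bool using (Bool; true; false; T?; not; _∧_; _∨_; if_then_else_)
open import Data.Nat using (ℕ; zero; suc; _≤_; _<_; _⊔_)
open import Data.Fin using (Fin)
open import Data.Fin.Properties using () renaming (_≟_ to _≟F_)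
open import Data.List using (List; []; _∷_; length; filter; map; foldr; allFin; concatMap; _++_)
open import Data.List.Membership.Propositional using (_∈_)
open import Data.List.Relation.Unary.Unique.Propositional using (Unique)
open import Data.Product using (Σ; ∃; _×_; _,_)
open import Data.Sum using (_⊎_; inj₁; inj₂)
import Data.Sum.Properties as SumP
import Data.Product.Properties as ProdP
open import Relation.Nullary using (¬_; Dec; yes; no; does)
open import Relation.Binary.PropositionalEquality using (_≡_; refl)
open import Relation.Binary.Definitions using (DecidableEquality)

record SimpleGraph (k : ℕ) : Set where
  field
    adj    : Fin k → Fin k → Bool
    sym    : ∀ x y → adj x y ≡ adj y x
    irrefl : ∀ x → adj x x ≡ false
open SimpleGraph public

data Reach {k : ℕ} (G : SimpleGraph k) (x : Fin k) : Fin k → Set where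
  here : Reach G x x
  step : ∀ {y z} → Reach G x y → adj G y z ≡ true → Reach G x z

Connected : {k : ℕ} → SimpleGraph k → Set
Connected {k} G = Fin k × (∀ x y → Reach G x y)

degree : {k : ℕ} → SimpleGraph k → Fin k → ℕ
degree {k} G x = length (filter (λ y → T? (adj G x y)) (allFin k))

maxDegree : {k : ℕ} → SimpleGraph k → ℕ
maxDegree {k} G = foldr _⊔_ 0 (map (degree G) (allFin k))

record FinGraph : Set₁ where
  field
    V   : Set
    _≟_ : DecidableEquality V
    vs  : List V
    E : V → V → Bool

module Alg (Γ : FinGraph) where
  open FinGraph Γ

  ⌊_⌋ : ∀ {P : Set} → Dec P → Bool
  ⌊ d ⌋ = does d

  count : (V → Bool) → ℕ
  count p = length (filter (λ w → T? (p w)) vs)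

  anyL : (V → Bool) → List V → Bool
  anyL p [] = false
  anyL p (x ∷ xs) = p x ∨ anyL p xs

  inN : List V → V → Bool
  inN D w = anyL (λ x → ⌊ x ≟ w ⌋ ∨ E x w) D

  -- w ∈ N̄[D]  (N̄(x) = vertices other than x not adjacent to x)
  inNbar : List V → V → Bool
  inNbar D w = anyL (λ x → ⌊ x ≟ w ⌋ ∨ (not ⌊ x ≟ w ⌋ ∧ not (E x w))) D

  -- |N_{V∖N[D]}[v]|   where N_A[v] = (N(v) ∩ A) ∪ {v}
  score₁ : List V → V → ℕ
  score₁ D v = count (λ w → ⌊ w ≟ v ⌋ ∨ (E v w ∧ not (inN D w)))

  -- |N̄_{V∖N̄[D]}[v]|  where N̄_A[v] = (N̄(v) ∩ A) ∪ {v}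
  score₂ : List V → V → ℕ
  score₂ D v = count (λ w → ⌊ w ≟ v ⌋ ∨ (not ⌊ w ≟ v ⌋ ∧ not (E v w) ∧ not (inNbar D w)))

  Dominating : List V → Set
  Dominating D = ∀ x → ¬ x ∈ D → Σ V λ y → y ∈ D × E x y ≡ true

  DominatingC : List V → Set
  DominatingC D = ∀ x → ¬ x ∈ D → Σ V λ y → y ∈ D × ¬ x ≡ y × E x y ≡ false

  GlobalDominating : List V → Set
  GlobalDominating D = (Σ V λ x → x ∈ D) × Dominating D × DominatingC D

  Best₁ : List V → V → Set
  Best₁ D v = ¬ v ∈ D
    × (∀ w → ¬ w ∈ D → score₁ D w ≤ score₁ D v)
    × (∀ w → ¬ w ∈ D → score₁ D w ≡ score₁ D v → score₂ D w ≤ score₂ D v)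

  Best₂ : List V → V → Set
  Best₂ D u = ¬ u ∈ D
    × (∀ w → ¬ w ∈ D → score₂ D w ≤ score₂ D u)
    × (∀ w → ¬ w ∈ D → score₂ D w ≡ score₂ D u → score₁ D w ≤ score₁ D u)

  data Step₁ : List V → List V → Set where
    skip : ∀ {D} → Dominating D → Step₁ D D
    pick : ∀ {D v} → ¬ Dominating D → Best₁ D v → Step₁ D (v ∷ D)

  data Step₂ : List V → List V → Set where
    skip : ∀ {D} → DominatingC D → Step₂ D D
    pick : ∀ {D u} → ¬ DominatingC D → Best₂ D u → Step₂ D (u ∷ D)

  -- H2Run D E : starting from current set D, some execution of Algorithm H2
  -- (with some tie-breaking) terminates with output E.
  data H2Run : List V → List V → Set where
    stop : ∀ {D} → GlobalDominating D → H2Run D D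
    iter : ∀ {D D₁ D₂ E} → ¬ GlobalDominating D → Step₁ D D₁ → Step₂ D₁ D₂
         → H2Run D₂ E → H2Run D E

-- The graph G' = G ∘_{v_i} H_i.
-- Vertices: inj₁ a  (a vertex g_a of G)  or  inj₂ (i , x)  (vertex x of H_i).

module Corona {n : ℕ} (G : SimpleGraph n) (m : Fin n → ℕ)
              (H : (i : Fin n) → SimpleGraph (suc (m i)))
              (c : (i : Fin n) → Fin (suc (m i))) where

  V' : Set
  V' = Fin n ⊎ Σ (Fin n) (λ i → Fin (suc (m i)))

  _≟'_ : DecidableEquality V'
  _≟'_ = SumP.≡-dec _≟F_ (ProdP.≡-dec _≟F_ _≟F_)

  vs' : List V'
  vs' = map inj₁ (allFin n)
     ++ concatMap (λ i → map (λ x → inj₂ (i , x)) (allFin (suc (m i)))) (allFin n)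

  adj' : V' → V' → Bool
  adj' (inj₁ a) (inj₁ b) = adj G a b
  adj' (inj₁ a) (inj₂ (j , y)) = does (a ≟F j) ∧ does (y ≟F c j)
  adj' (inj₂ (i , x)) (inj₁ b) = does (b ≟F i) ∧ does (x ≟F c i)
  adj' (inj₂ (i , x)) (inj₂ (j , y)) with i ≟F j
  ... | yes refl = adj (H i) x y
  ... | no _ = false

  G' : FinGraph
  G' = record { V = V' ; _≟_ = _≟'_ ; vs = vs' ; E = adj' }

-- Write g_a for the vertices of G, v_i for the centre of H_i, and call {g_i} ∪ H_i
-- the i-th block.  While D consists of centres and misses some v_t, the vertex v_t
-- covers g_t and all of H_t, so its first score is at least m_t + 2, whereas g_a scores
-- at most deg(a) + 2 < m_t + 2 and a leaf of H_l scores at most m_l + 1 (at most 1 once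
-- v_l ∈ D): step (1) always adds a centre.  After the first step D = {v_i}; every other
-- centre then attains the largest second score, so the tie-break of step (2) again
-- forces a centre.  From then on D holds two centres, hence dominates the complement,
-- and only step (1) runs: the output consists of at most n centres.  Every dominating
-- set meets every block, because a leaf of H_i has all its neighbours in H_i, so it has
-- at least n vertices.  For n = 1 the algorithm stops after one iteration with two
-- vertices, and no single vertex is a global dominating set.

module Submission where

open import Defs hiding (sym)
open import Data.Bool using (Bool; true; false; T; not; _∧_; _∨_)
open import Data.Bool.Properties using (T-∨; T-∧; T-≡; T-not-≡; ∨-identityʳ) renaming (_≟_ to _≟B_)
open import Data.Empty using (⊥; ⊥-elim)
open import Data.Nat using (ℕ; zero; suc; _≤_; _<_; _+_; _⊔_; z≤n; s≤s)
open import Data.Nat.Properties hiding (_≟_)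
open import Data.Fin as Fin using (Fin; fromℕ) renaming (_≤_ to _≤F_)
open import Data.Fin.Properties using (¬∀⟶∃¬; ≤fromℕ) renaming (_≟_ to _≟F_)
open import Data.List using (List; []; _∷_; length; filter; _++_; map; foldr; allFin; concatMap)
open import Data.List.Properties using (length-++; length-map; length-tabulate)
open import Data.List.Membership.Propositional using (_∈_; _∉_; find; lose)
open import Data.List.Membership.Propositional.Properties
  using (∈-∃++; ∈-filter⁺; ∈-filter⁻; ∈-map⁺; ∈-map⁻; ∈-allFin; ∈-++⁺ˡ; ∈-++⁺ʳ; ∈-concatMap⁺; ∈-concatMap⁻)
open import Data.List.Relation.Binary.Disjoint.Propositional using (Disjoint)
open import Data.List.Relation.Binary.Subset.Propositional using (_⊆_)
open import Data.List.Relation.Unary.Any as Any using (here; there)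
open import Data.List.Relation.Unary.All as All using (All; []; _∷_)
import Data.List.Relation.Unary.All.Properties as AllP
import Data.List.Relation.Unary.AllPairs as AllPairs
import Data.List.Relation.Unary.AllPairs.Properties as AllPairsP
open import Data.List.Relation.Unary.Unique.Propositional using (Unique; []; _∷_)
import Data.List.Relation.Unary.Unique.Propositional.Properties as Unique
open import Data.Product using (Σ; _×_; _,_; proj₁; proj₂)
open import Data.Product.Relation.Binary.Lex.NonStrict using (×-totalOrder)
open import Data.Sum using (_⊎_; inj₁; inj₂)
open import Data.Sum.Properties using (inj₁-injective)
open import Function using (Equivalence)
open import Relation.Nullary using (¬_; Dec; yes; no; does; contradiction)
open import Relation.Nullary.Decidable using (T?; map′; ¬?; _×-dec_; _⊎-dec_)
open import Relation.Binary.PropositionalEquality using (_≡_; _≢_; refl; sym; trans; cong; subst)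
open import Relation.Binary.Definitions using (DecidableEquality)

open Equivalence using (to; from)

¬T⇒T-not : ∀ {b} → ¬ T b → T (not b)
¬T⇒T-not {true} ¬t = ¬t _
¬T⇒T-not {false} _ = _

T-not⇒¬T : ∀ {b} → T (not b) → ¬ T b
T-not⇒¬T {false} _ ()

module _ {P : Set} where

  T-does⁺ : (d : Dec P) → P → T (does d)
  T-does⁺ (yes _) _ = _
  T-does⁺ (no ¬p) p = ¬p p

  T-does⁻ : (d : Dec P) → T (does d) → P
  T-does⁻ (yes p) _ = p

  T-not-does⁺ : (d : Dec P) → ¬ P → T (not (does d))
  T-not-does⁺ (yes p) ¬p = ¬p p
  T-not-does⁺ (no _) _ = _

  T-not-does⁻ : (d : Dec P) → T (not (does d)) → ¬ P
  T-not-does⁻ (no ¬p) _ = ¬p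

singleton-or-other : ∀ k → (∀ (a b : Fin (suc k)) → a ≡ b) ⊎ (∀ i → Σ (Fin (suc k)) (_≢ i))
singleton-or-other zero = inj₁ λ { Fin.zero Fin.zero → refl }
singleton-or-other (suc k) = inj₂ λ { Fin.zero → Fin.suc Fin.zero , λ () ; (Fin.suc _) → Fin.zero , λ () }

length-map-allFin : ∀ {A : Set} {n} (f : Fin n → A) → length (map f (allFin n)) ≡ n
length-map-allFin f = trans (length-map f (allFin _)) (length-tabulate (λ x → x))

∈⇒≤foldr-⊔ : ∀ {A : Set} (f : A → ℕ) {x} xs → x ∈ xs → f x ≤ foldr _⊔_ 0 (map f xs)
∈⇒≤foldr-⊔ f (y ∷ xs) (here refl) = m≤m⊔n (f y) _
∈⇒≤foldr-⊔ f (y ∷ xs) (there x∈xs) = ≤-trans (∈⇒≤foldr-⊔ f xs x∈xs) (m≤n⊔m (f y) _)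

module Counting {A : Set} where

  countIn : (A → Bool) → List A → ℕ
  countIn p L = length (filter (λ w → T? (p w)) L)

  unique-⊆⇒length≤ : ∀ {xs ys : List A} → Unique xs → xs ⊆ ys → length xs ≤ length ys
  unique-⊆⇒length≤ {[]} _ _ = z≤n
  unique-⊆⇒length≤ {x ∷ xs} {ys} (x∉xs ∷ uxs) xs⊆ys with ∈-∃++ (xs⊆ys (here refl))
  ... | as , bs , refl = begin
    suc (length xs)             ≤⟨ s≤s (unique-⊆⇒length≤ uxs xs⊆as++bs) ⟩
    suc (length (as ++ bs))     ≡⟨ cong suc (length-++ as) ⟩
    suc (length as + length bs) ≡⟨ sym (+-suc (length as) (length bs)) ⟩
    length as + suc (length bs) ≡⟨ sym (length-++ as) ⟩
    length (as ++ x ∷ bs)       ∎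
    where
    open ≤-Reasoning
    remove : ∀ cs {z} → z ∈ cs ++ x ∷ bs → z ≢ x → z ∈ cs ++ bs
    remove []       (here z≡x)  z≢x = contradiction z≡x z≢x
    remove []       (there z∈)  _   = z∈
    remove (c ∷ cs) (here z≡c)  _   = here z≡c
    remove (c ∷ cs) (there z∈)  z≢x = there (remove cs z∈ z≢x)
    xs⊆as++bs : xs ⊆ as ++ bs
    xs⊆as++bs z∈xs = remove as (xs⊆ys (there z∈xs)) λ z≡x → All.lookup x∉xs z∈xs (sym z≡x)

  ∉⇒unique-∷ : ∀ {x} {xs : List A} → x ∉ xs → Unique xs → Unique (x ∷ xs)
  ∉⇒unique-∷ {xs = xs} x∉xs uxs = AllP.¬Any⇒All¬ xs x∉xs ∷ uxs

  countIn-≥ : ∀ (p : A → Bool) {L M} → Unique M → (∀ {w} → w ∈ M → w ∈ L × T (p w)) →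
              length M ≤ countIn p L
  countIn-≥ p uM sub = unique-⊆⇒length≤ uM λ w∈M → let (w∈L , pw) = sub w∈M in
    ∈-filter⁺ (λ w → T? (p w)) w∈L pw

  countIn-≤ : ∀ (p : A → Bool) {L M} → Unique L → (∀ {w} → w ∈ L → T (p w) → w ∈ M) →
              countIn p L ≤ length M
  countIn-≤ p uL sub = unique-⊆⇒length≤ (Unique.filter⁺ (λ w → T? (p w)) uL) λ w∈ →
    let (w∈L , pw) = ∈-filter⁻ (λ w → T? (p w)) w∈ in sub w∈L pw

  countIn-mono : ∀ (p q : A → Bool) {L} → Unique L → (∀ w → T (p w) → T (q w)) →
                 countIn p L ≤ countIn q L
  countIn-mono p q uL p⇒q = countIn-≤ p uL λ w∈L pw → ∈-filter⁺ (λ w → T? (q w)) w∈L (p⇒q _ pw)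

  countIn-< : ∀ (p q : A → Bool) {L w} → Unique L → (∀ w → T (p w) → T (q w)) →
              w ∈ L → T (q w) → ¬ T (p w) → countIn p L < countIn q L
  countIn-< p q {L} {w} uL p⇒q w∈L qw ¬pw =
    countIn-≥ q (∉⇒unique-∷ w∉ (Unique.filter⁺ (λ w → T? (p w)) uL)) sub
    where
    w∉ : w ∉ filter (λ w → T? (p w)) L
    w∉ w∈ = ¬pw (proj₂ (∈-filter⁻ (λ w → T? (p w)) {xs = L} w∈))
    sub : ∀ {z} → z ∈ w ∷ filter (λ w → T? (p w)) L → z ∈ L × T (q z)
    sub (here refl) = w∈L , qw
    sub (there z∈)  = let (z∈L , pz) = ∈-filter⁻ (λ w → T? (p w)) z∈ in z∈L , p⇒q _ pz

  countIn-split : ∀ (p r : A → Bool) L →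
    countIn p L ≡ countIn (λ w → p w ∧ r w) L + countIn (λ w → p w ∧ not (r w)) L
  countIn-split p r [] = refl
  countIn-split p r (x ∷ L) with p x | r x
  ... | true  | true  = cong suc (countIn-split p r L)
  ... | true  | false = trans (cong suc (countIn-split p r L)) (sym (+-suc _ _))
  ... | false | _     = countIn-split p r L

  countIn-exchange : DecidableEquality A → ∀ (p q : A → Bool) {L} → Unique L → ∀ {u t} →
    t ∈ L → T (q t) → (∀ w → T (p w) → w ≢ u → T (q w) × w ≢ t) → countIn p L ≤ countIn q L
  countIn-exchange _≟_ p q {L} uL {u} {t} t∈L qt p-u⇒q-t = begin
    countIn p L                                ≡⟨ countIn-split p (is u) L ⟩
    countIn (p ∧is u) L + countIn (p ∧isn't u) L ≤⟨ +-mono-≤ at-most-u (countIn-mono _ _ uL rest) ⟩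
    1 + countIn (q ∧isn't t) L                 ≤⟨ +-monoˡ-≤ _ at-least-t ⟩
    countIn (q ∧is t) L + countIn (q ∧isn't t) L ≡⟨ sym (countIn-split q (is t) L) ⟩
    countIn q L                                ∎
    where
    open ≤-Reasoning
    is : A → A → Bool
    is a w = does (w ≟ a)
    _∧is_ _∧isn't_ : (A → Bool) → A → A → Bool
    (s ∧is a) w = s w ∧ is a w
    (s ∧isn't a) w = s w ∧ not (is a w)
    at-most-u : countIn (p ∧is u) L ≤ 1
    at-most-u = countIn-≤ (p ∧is u) {M = u ∷ []} uL λ {w} _ pw → here (T-does⁻ (w ≟ u) (proj₂ (to T-∧ pw)))
    at-least-t : 1 ≤ countIn (q ∧is t) L
    at-least-t = countIn-≥ (q ∧is t) ([] ∷ []) λ { (here refl) → t∈L , from T-∧ (qt , T-does⁺ (t ≟ t) refl) }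
    rest : ∀ w → T ((p ∧isn't u) w) → T ((q ∧isn't t) w)
    rest w pw with to T-∧ pw
    ... | pw , w≢u with p-u⇒q-t w pw (T-not-does⁻ (w ≟ u) w≢u)
    ... | qw , w≢t = from T-∧ (qw , T-not-does⁺ (w ≟ t) w≢t)

module AlgProperties (Γ : FinGraph) where
  open FinGraph Γ
  open Alg Γ
  open Counting using (∉⇒unique-∷)

  anyL⁺ : ∀ (p : V → Bool) {x} D → x ∈ D → T (p x) → T (anyL p D)
  anyL⁺ p (y ∷ D) (here refl) px = from T-∨ (inj₁ px)
  anyL⁺ p (y ∷ D) (there x∈D) px = from T-∨ (inj₂ (anyL⁺ p D x∈D px))

  anyL⁻ : ∀ (p : V → Bool) D → T (anyL p D) → Σ V λ x → x ∈ D × T (p x)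
  anyL⁻ p (y ∷ D) any with to T-∨ any
  ... | inj₁ py = y , here refl , py
  ... | inj₂ any′ = let (x , x∈D , px) = anyL⁻ p D any′ in x , there x∈D , px

  step₁-unique : ∀ {D D₁} → Step₁ D D₁ → Unique D → Unique D₁
  step₁-unique (skip _) = λ uD → uD
  step₁-unique (pick _ (v∉D , _)) = ∉⇒unique-∷ v∉D

  step₂-unique : ∀ {D D₂} → Step₂ D D₂ → Unique D → Unique D₂
  step₂-unique (skip _) = λ uD → uD
  step₂-unique (pick _ (u∉D , _)) = ∉⇒unique-∷ u∉D

  run-invariant : (P : List V → Set) →
    (∀ {D D₁ D₂} → ¬ GlobalDominating D → Step₁ D D₁ → Step₂ D₁ D₂ → P D → P D₂) →
    ∀ {D F} → H2Run D F → P D → P F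
  run-invariant P preserve (stop _) pD = pD
  run-invariant P preserve (iter ¬gd s₁ s₂ run) pD = run-invariant P preserve run (preserve ¬gd s₁ s₂ pD)

  run-unique : ∀ {D F} → H2Run D F → Unique D → Unique F
  run-unique = run-invariant Unique λ _ s₁ s₂ uD → step₂-unique s₂ (step₁-unique s₁ uD)

  run-globalDominating : ∀ {D F} → H2Run D F → GlobalDominating F
  run-globalDominating (stop gd) = gd
  run-globalDominating (iter _ _ _ run) = run-globalDominating run

  run-stops : ∀ {D F} → GlobalDominating D → H2Run D F → F ≡ D
  run-stops _ (stop _) = refl
  run-stops gd (iter ¬gd _ _ _) = contradiction gd ¬gd

  globalDominating-length≥2 : ∀ {x y} → x ≢ y → ∀ {S} → GlobalDominating S → 2 ≤ length S
  globalDominating-length≥2 _ {[]} ((_ , ()) , _)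
  globalDominating-length≥2 _ {_ ∷ _ ∷ _} _ = s≤s (s≤s z≤n)
  globalDominating-length≥2 {x} {y} x≢y {z ∷ []} (_ , dom , domC) = ⊥-elim (adjacent-and-not other)
    where
    other : Σ V (_∉ z ∷ [])
    other with x ≟ z
    ... | yes refl = y , λ { (here y≡x) → x≢y (sym y≡x) }
    ... | no x≢z = x , λ { (here x≡z) → x≢z x≡z }
    adjacent-and-not : Σ V (_∉ z ∷ []) → ⊥
    adjacent-and-not (w , w∉) with dom w w∉ | domC w w∉
    ... | _ , here refl , wz | _ , here refl , _ , wz′ = contradiction (trans (sym wz) wz′) λ ()

module H2Termination (Γ : FinGraph) (complete : ∀ x → x ∈ FinGraph.vs Γ) (x₀ : FinGraph.V Γ) where
  open FinGraph Γ
  open Alg Γ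
  open AlgProperties Γ
  open Counting using (unique-⊆⇒length≤; ∉⇒unique-∷)
  open import Data.List.Membership.DecPropositional _≟_ using (_∈?_)
  open import Data.List.Extrema (×-totalOrder ≤-decTotalOrder ≤-totalOrder) using (argmax; argmax-sel; f[xs]≤f[argmax])

  DominatedBy : (V → V → Set) → List V → Set
  DominatedBy R D = ∀ x → x ∉ D → Σ V λ y → y ∈ D × R x y

  dominatedBy? : ∀ {R} → (∀ x y → Dec (R x y)) → ∀ D → Dec (DominatedBy R D)
  dominatedBy? R? D = map′ fromAll toAll (All.all? (λ x → x ∈? D ⊎-dec Any.any? (R? x) D) vs)
    where
    fromAll : All (λ x → x ∈ D ⊎ Any.Any _ D) vs → DominatedBy _ D
    fromAll all x x∉D with All.lookup all (complete x)
    ... | inj₁ x∈D = contradiction x∈D x∉D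
    ... | inj₂ any = find any
    toAll : DominatedBy _ D → All (λ x → x ∈ D ⊎ Any.Any _ D) vs
    toAll dom = All.tabulate λ {x} _ → case (x ∈? D)
      where
      case : ∀ {x} → Dec (x ∈ D) → x ∈ D ⊎ Any.Any _ D
      case (yes x∈D) = inj₁ x∈D
      case {x} (no x∉D) = let (y , y∈D , rxy) = dom x x∉D in inj₂ (lose y∈D rxy)

  dominating? : ∀ D → Dec (Dominating D)
  dominating? = dominatedBy? λ x y → E x y ≟B true

  dominatingC? : ∀ D → Dec (DominatingC D)
  dominatingC? = dominatedBy? λ x y → ¬? (x ≟ y) ×-dec (E x y ≟B false)

  globalDominating? : ∀ D → Dec (GlobalDominating D)
  globalDominating? [] = no λ { ((_ , ()) , _) }
  globalDominating? D@(x ∷ _) = map′ ((x , here refl) ,_) proj₂ (dominating? D ×-dec dominatingC? D)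

  vertexOutside : ∀ {R} D → ¬ DominatedBy R D → Σ V (_∉ D)
  vertexOutside D ¬dom with Any.any? (λ x → ¬? (x ∈? D)) vs
  ... | yes any = let (x , _ , x∉D) = find any in x , x∉D
  ... | no ¬any = contradiction (λ x x∉D → contradiction (lose (complete x) x∉D) ¬any) ¬dom

  lexMaxOutside : ∀ (f g : V → ℕ) D → Σ V (_∉ D) →
    Σ V λ v → v ∉ D × (∀ w → w ∉ D → f w ≤ f v) × (∀ w → w ∉ D → f w ≡ f v → g w ≤ g v)
  lexMaxOutside f g D (b , b∉D) =
    v , v∉D , (λ w w∉D → proj₁ (lex⇒ w w∉D)) , (λ w w∉D → proj₂ (lex⇒ w w∉D))
    where
    outside = filter (λ x → ¬? (x ∈? D)) vs
    key : V → ℕ × ℕ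
    key v = f v , g v
    v = argmax key b outside
    v∉D : v ∉ D
    v∉D with argmax-sel key b outside
    ... | inj₁ v≡b = subst (_∉ D) (sym v≡b) b∉D
    ... | inj₂ v∈ = proj₂ (∈-filter⁻ (λ x → ¬? (x ∈? D)) {xs = vs} v∈)
    lex⇒ : ∀ w → w ∉ D → f w ≤ f v × (f w ≡ f v → g w ≤ g v)
    lex⇒ w w∉D with All.lookup (f[xs]≤f[argmax] b outside) (∈-filter⁺ (λ x → ¬? (x ∈? D)) (complete w) w∉D)
    ... | inj₁ (fw≤fv , fw≢fv) = fw≤fv , λ fw≡fv → contradiction fw≡fv fw≢fv
    ... | inj₂ (fw≡fv , gw≤gv) = ≤-reflexive fw≡fv , λ _ → gw≤gv

  best₁-exists : ∀ D → ¬ Dominating D → Σ V (Best₁ D)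
  best₁-exists D ¬dom = lexMaxOutside (score₁ D) (score₂ D) D (vertexOutside D ¬dom)

  best₂-exists : ∀ D → ¬ DominatingC D → Σ V (Best₂ D)
  best₂-exists D ¬domC = lexMaxOutside (score₂ D) (score₁ D) D (vertexOutside D ¬domC)

  dominating⇒nonempty : ∀ {D} → Dominating D → Σ V (_∈ D)
  dominating⇒nonempty {D} dom with x₀ ∈? D
  ... | yes x₀∈D = x₀ , x₀∈D
  ... | no x₀∉D = let (y , y∈D , _) = dom x₀ x₀∉D in y , y∈D

  Iteration : List V → Set
  Iteration D = Σ (List V) λ D₁ → Σ (List V) λ D₂ →
    Step₁ D D₁ × Step₂ D₁ D₂ × Unique D₂ × length D < length D₂

  iteration : ∀ D → Unique D → ¬ GlobalDominating D → Iteration D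
  iteration D uD ¬gd = after-step₁ (dominating? D)
    where
    after-step₁ : Dec (Dominating D) → Iteration D
    after-step₁ (yes dom) with dominatingC? D
    ... | yes domC = contradiction (dominating⇒nonempty dom , dom , domC) ¬gd
    ... | no ¬domC = let (u , best-u) = best₂-exists D ¬domC in
          D , u ∷ D , skip dom , pick ¬domC best-u , ∉⇒unique-∷ (proj₁ best-u) uD , ≤-refl
    after-step₁ (no ¬dom) = after-pick (best₁-exists D ¬dom)
      where
      after-pick : Σ V (Best₁ D) → Iteration D
      after-pick (v , best-v) with dominatingC? (v ∷ D)
      ... | yes domC = v ∷ D , v ∷ D , pick ¬dom best-v , skip domC , ∉⇒unique-∷ (proj₁ best-v) uD , ≤-refl
      ... | no ¬domC = let (u , best-u) = best₂-exists (v ∷ D) ¬domC in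
            v ∷ D , u ∷ v ∷ D , pick ¬dom best-v , pick ¬domC best-u ,
            ∉⇒unique-∷ (proj₁ best-u) (∉⇒unique-∷ (proj₁ best-v) uD) , n≤1+n _

  run-within : ∀ fuel D → Unique D → length vs ≤ fuel + length D → Σ (List V) (H2Run D)
  run-within fuel D uD bound with globalDominating? D
  ... | yes gd = D , stop gd
  run-within zero D uD bound | no ¬gd =
    let (_ , D₂ , _ , _ , uD₂ , longer) = iteration D uD ¬gd
    in contradiction (unique-⊆⇒length≤ uD₂ λ {x} _ → complete x) (<⇒≱ (<-≤-trans (s≤s bound) longer))
  run-within (suc fuel) D uD bound | no ¬gd =
    let (D₁ , D₂ , s₁ , s₂ , uD₂ , longer) = iteration D uD ¬gd
        (F , run) = run-within fuel D₂ uD₂ (begin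
          length vs            ≤⟨ bound ⟩
          suc fuel + length D  ≡⟨ sym (+-suc fuel (length D)) ⟩
          fuel + suc (length D) ≤⟨ +-monoʳ-≤ fuel longer ⟩
          fuel + length D₂     ∎)
    in F , iter ¬gd s₁ s₂ run
    where open ≤-Reasoning

  run-exists : Σ (List V) (H2Run [])
  run-exists = run-within (length vs) [] [] (≤-reflexive (sym (+-identityʳ _)))

module CoronaGraph {n : ℕ} (G : SimpleGraph n) (m : Fin n → ℕ)
  (H : (i : Fin n) → SimpleGraph (suc (m i))) (c : (i : Fin n) → Fin (suc (m i)))
  (star : ∀ i x → x ≢ c i → adj (H i) (c i) x ≡ true) where
  open Corona G m H c
  open Alg G'
  open AlgProperties G'
  open Counting using (∉⇒unique-∷; countIn-≥; countIn-≤; countIn-<; countIn-exchange)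

  g : Fin n → V'
  g a = inj₁ a

  h : (i : Fin n) → Fin (suc (m i)) → V'
  h i x = inj₂ (i , x)

  centre : Fin n → V'
  centre i = h i (c i)

  block : V' → Fin n
  block (inj₁ a) = a
  block (inj₂ (i , _)) = i

  blockList : Fin n → List V'
  blockList i = map (h i) (allFin (suc (m i)))

  vs'-complete : ∀ x → x ∈ vs'
  vs'-complete (inj₁ a) = ∈-++⁺ˡ (∈-map⁺ inj₁ (∈-allFin a))
  vs'-complete (inj₂ (i , x)) = ∈-++⁺ʳ (map inj₁ (allFin n))
    (∈-concatMap⁺ blockList (Any.map (λ { refl → ∈-map⁺ (h i) (∈-allFin x) }) (∈-allFin i)))

  h-injective : ∀ {i} {x y : Fin (suc (m i))} → h i x ≡ h i y → x ≡ y
  h-injective refl = refl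

  blockList-unique : ∀ i → Unique (blockList i)
  blockList-unique i = Unique.map⁺ h-injective (Unique.allFin⁺ _)

  ∈-blockList⇒block : ∀ i {w} → w ∈ blockList i → block w ≡ i
  ∈-blockList⇒block i w∈ with ∈-map⁻ (h i) w∈
  ... | _ , _ , refl = refl

  g∉blockList : ∀ a i → g a ∉ blockList i
  g∉blockList a i g∈ with ∈-map⁻ (h i) g∈
  ... | _ , _ , ()

  vs'-unique : Unique vs'
  vs'-unique = Unique.++⁺ (Unique.map⁺ inj₁-injective (Unique.allFin⁺ n))
    (Unique.concat⁺ (AllP.map⁺ (All.tabulate λ {i} _ → blockList-unique i))
                    (AllPairsP.map⁺ (AllPairs.map blocks-disjoint (Unique.allFin⁺ n))))
    λ (w∈G , w∈H) → g-not-in-H w∈G (∈-concatMap⁻ blockList {xs = allFin n} w∈H)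
    where
    blocks-disjoint : ∀ {i j} → i ≢ j → Disjoint (blockList i) (blockList j)
    blocks-disjoint i≢j (w∈i , w∈j) = i≢j (trans (sym (∈-blockList⇒block _ w∈i)) (∈-blockList⇒block _ w∈j))
    g-not-in-H : ∀ {w} → w ∈ map inj₁ (allFin n) → Any.Any (λ i → w ∈ blockList i) (allFin n) → ⊥
    g-not-in-H w∈G w∈H with ∈-map⁻ inj₁ w∈G | Any.satisfied w∈H
    ... | a , _ , refl | i , g∈i = g∉blockList a i g∈i

  adj'-same-block : ∀ i x y → adj' (h i x) (h i y) ≡ adj (H i) x y
  adj'-same-block i x y with i ≟F i
  ... | yes refl = refl
  ... | no i≢i = contradiction refl i≢i

  adj'-other-block : ∀ {i j} x y → i ≢ j → adj' (h i x) (h j y) ≡ false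
  adj'-other-block {i} {j} x y i≢j with i ≟F j
  ... | yes i≡j = contradiction i≡j i≢j
  ... | no _ = refl

  adj'-sym : ∀ u w → adj' u w ≡ adj' w u
  adj'-sym (inj₁ a) (inj₁ b) = SimpleGraph.sym G a b
  adj'-sym (inj₁ _) (inj₂ _) = refl
  adj'-sym (inj₂ _) (inj₁ _) = refl
  adj'-sym (inj₂ (i , x)) (inj₂ (j , y)) = hh-sym (i ≟F j)
    where
    hh-sym : Dec (i ≡ j) → adj' (h i x) (h j y) ≡ adj' (h j y) (h i x)
    hh-sym (yes refl) = trans (adj'-same-block i x y) (trans (SimpleGraph.sym (H i) x y) (sym (adj'-same-block i y x)))
    hh-sym (no i≢j) = trans (adj'-other-block x y i≢j) (sym (adj'-other-block y x λ j≡i → i≢j (sym j≡i)))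

  adjacent-sym : ∀ u w → T (adj' u w) → adj' w u ≡ true
  adjacent-sym u w adj = trans (adj'-sym w u) (to T-≡ adj)

  nonadjacent-sym : ∀ u w → ¬ T (adj' u w) → adj' w u ≡ false
  nonadjacent-sym u w ¬adj = trans (adj'-sym w u) (to T-not-≡ (¬T⇒T-not ¬adj))

  centre-adj : ∀ i w → block w ≡ i → w ≢ centre i → T (adj' (centre i) w)
  centre-adj i (inj₁ .i) refl _ = from T-∧ (T-does⁺ (i ≟F i) refl , T-does⁺ (c i ≟F c i) refl)
  centre-adj i (inj₂ (.i , y)) refl w≢centre =
    subst T (sym (adj'-same-block i (c i) y)) (from T-≡ (star i y λ y≡c → w≢centre (cong (h i) y≡c)))

  other-block-¬adj : ∀ i x w → block w ≢ i → ¬ T (adj' (h i x) w)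
  other-block-¬adj i x (inj₁ b) b≢i adj = b≢i (T-does⁻ (b ≟F i) (proj₁ (to T-∧ adj)))
  other-block-¬adj i x (inj₂ (j , y)) j≢i adj =
    subst T (adj'-other-block x y λ i≡j → j≢i (sym i≡j)) adj

  g-neighbours : ∀ a w → T (adj' (g a) w) → (Σ (Fin n) λ b → w ≡ g b × T (adj G a b)) ⊎ w ≡ centre a
  g-neighbours a (inj₁ b) adj = inj₁ (b , refl , adj)
  g-neighbours a (inj₂ (j , y)) adj with to T-∧ adj
  ... | a≡j , y≡c with T-does⁻ (a ≟F j) a≡j | T-does⁻ (y ≟F c j) y≡c
  ...   | refl | refl = inj₂ refl

  leaf-neighbours : ∀ i x w → x ≢ c i → T (adj' (h i x) w) → Σ (Fin (suc (m i))) λ y → w ≡ h i y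
  leaf-neighbours i x (inj₁ b) x≢c adj = contradiction (T-does⁻ (x ≟F c i) (proj₂ (to T-∧ adj))) x≢c
  leaf-neighbours i x (inj₂ (j , y)) x≢c adj with i ≟F j
  ... | yes refl = y , refl

  length-blockList : ∀ i → length (blockList i) ≡ suc (m i)
  length-blockList i = length-map-allFin (h i)

  IsCentre : V' → Set
  IsCentre x = Σ (Fin n) λ l → x ≡ centre l

  AllCentres : List V' → Set
  AllCentres D = ∀ {x} → x ∈ D → IsCentre x

  ¬inN-uncovered-block : ∀ {D t} w → AllCentres D → centre t ∉ D → block w ≡ t → ¬ T (inN D w)
  ¬inN-uncovered-block {D} {t} w centres t∉D w∈t inN with anyL⁻ _ D inN
  ... | x , x∈D , x-covers-w with centres x∈D
  ...   | l , refl = t∉D (subst (λ s → centre s ∈ D) l≡t x∈D)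
    where
    l≡t : l ≡ t
    l≡t with to T-∨ x-covers-w | l ≟F t
    ... | inj₁ centre≡w | _ = trans (cong block (T-does⁻ (centre l ≟' w) centre≡w)) w∈t
    ... | inj₂ _ | yes l≡t = l≡t
    ... | inj₂ adj | no l≢t = contradiction adj (other-block-¬adj l (c l) w λ w∈l → l≢t (trans (sym w∈l) w∈t))

  inN-covered-block : ∀ {D l} w → centre l ∈ D → block w ≡ l → T (inN D w)
  inN-covered-block {D} {l} w l∈D w∈l = anyL⁺ _ D l∈D covers
    where
    covers : T (does (centre l ≟' w) ∨ adj' (centre l) w)
    covers with centre l ≟' w
    ... | yes _ = _
    ... | no l≢w = centre-adj l w w∈l λ w≡l → l≢w (sym w≡l)

  -- score₁ D v and score₂ D v are definitionally countIn (countedᵢ D v) vs'.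
  counted₁ : List V' → V' → V' → Bool
  counted₁ D v w = does (w ≟' v) ∨ (adj' v w ∧ not (inN D w))

  score₁-centre≥ : ∀ D t → AllCentres D → centre t ∉ D → 2 + m t ≤ score₁ D (centre t)
  score₁-centre≥ D t centres t∉D = subst (_≤ score₁ D (centre t)) (cong suc (length-blockList t))
    (countIn-≥ (counted₁ D (centre t)) (∉⇒unique-∷ (g∉blockList t t) (blockList-unique t))
      λ {w} w∈ → vs'-complete w , counted w∈)
    where
    uncovered-neighbour : ∀ w → block w ≡ t → w ≢ centre t → T (counted₁ D (centre t) w)
    uncovered-neighbour w w∈t w≢centre = from T-∨ (inj₂ (from T-∧
      (centre-adj t w w∈t w≢centre , ¬T⇒T-not (¬inN-uncovered-block w centres t∉D w∈t))))
    counted : ∀ {w} → w ∈ g t ∷ blockList t → T (counted₁ D (centre t) w)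
    counted (here refl) = uncovered-neighbour (g t) refl λ ()
    counted (there w∈) with ∈-map⁻ (h t) w∈
    ... | y , _ , refl with y ≟F c t
    ...   | yes refl = from T-∨ (inj₁ (T-does⁺ (centre t ≟' centre t) refl))
    ...   | no y≢c = uncovered-neighbour (h t y) refl λ eq → y≢c (h-injective eq)

  score₁-g≤ : ∀ D a → score₁ D (g a) ≤ 2 + degree G a
  score₁-g≤ D a = subst (score₁ D (g a) ≤_) (cong (λ d → 2 + d) (length-map inj₁ neighbours))
    (countIn-≤ (counted₁ D (g a)) vs'-unique counted⇒∈)
    where
    neighbours = filter (λ y → T? (adj G a y)) (allFin n)
    counted⇒∈ : ∀ {w} → w ∈ vs' → T (counted₁ D (g a) w) → w ∈ g a ∷ centre a ∷ map inj₁ neighbours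
    counted⇒∈ {w} _ counted with to T-∨ counted
    ... | inj₁ w≡g = here (T-does⁻ (w ≟' g a) w≡g)
    ... | inj₂ adj∧uncovered with g-neighbours a w (proj₁ (to T-∧ adj∧uncovered))
    ...   | inj₁ (b , refl , ab) = there (there (∈-map⁺ inj₁ (∈-filter⁺ (λ y → T? (adj G a y)) (∈-allFin b) ab)))
    ...   | inj₂ refl = there (here refl)

  score₁-leaf≤ : ∀ D l x → x ≢ c l → score₁ D (h l x) ≤ 1 + m l
  score₁-leaf≤ D l x x≢c = subst (score₁ D (h l x) ≤_) (length-blockList l)
    (countIn-≤ (counted₁ D (h l x)) vs'-unique counted⇒∈)
    where
    counted⇒∈ : ∀ {w} → w ∈ vs' → T (counted₁ D (h l x) w) → w ∈ blockList l
    counted⇒∈ {w} _ counted with to T-∨ counted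
    ... | inj₁ w≡x rewrite T-does⁻ (w ≟' h l x) w≡x = ∈-map⁺ (h l) (∈-allFin x)
    ... | inj₂ adj∧uncovered with leaf-neighbours l x w x≢c (proj₁ (to T-∧ adj∧uncovered))
    ...   | y , refl = ∈-map⁺ (h l) (∈-allFin y)

  score₁-leaf≤1 : ∀ D l x → x ≢ c l → centre l ∈ D → score₁ D (h l x) ≤ 1
  score₁-leaf≤1 D l x x≢c l∈D = countIn-≤ (counted₁ D (h l x)) {M = h l x ∷ []} vs'-unique counted⇒∈
    where
    counted⇒∈ : ∀ {w} → w ∈ vs' → T (counted₁ D (h l x) w) → w ∈ h l x ∷ []
    counted⇒∈ {w} _ counted with to T-∨ counted
    ... | inj₁ w≡x = here (T-does⁻ (w ≟' h l x) w≡x)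
    ... | inj₂ adj∧uncovered with to T-∧ adj∧uncovered
    ...   | adj , uncovered with leaf-neighbours l x w x≢c adj
    ...     | y , refl = contradiction (inN-covered-block (h l y) l∈D refl) (T-not⇒¬T uncovered)

  counted₂ : List V' → V' → V' → Bool
  counted₂ D v w = does (w ≟' v) ∨ (not (does (w ≟' v)) ∧ not (adj' v w) ∧ not (inNbar D w))

  counted₂-self : ∀ D v → T (counted₂ D v v)
  counted₂-self D v = from T-∨ (inj₁ (T-does⁺ (v ≟' v) refl))

  counted₂⁺ : ∀ D v w → w ≢ v → ¬ T (adj' v w) → T (not (inNbar D w)) → T (counted₂ D v w)
  counted₂⁺ D v w w≢v ¬adj uncovered = from T-∨ (inj₂ (from T-∧
    (T-not-does⁺ (w ≟' v) w≢v , from T-∧ (¬T⇒T-not ¬adj , uncovered))))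

  counted₂⁻ : ∀ D v w → T (counted₂ D v w) → w ≡ v ⊎ (¬ T (adj' v w) × T (not (inNbar D w)))
  counted₂⁻ D v w counted with to T-∨ counted
  ... | inj₁ w≡v = inj₁ (T-does⁻ (w ≟' v) w≡v)
  ... | inj₂ rest with to T-∧ (proj₂ (to (T-∧ {not (does (w ≟' v))}) rest))
  ...   | ¬adj , uncovered = inj₂ (T-not⇒¬T ¬adj , uncovered)

  ¬inN̄-centre⁻ : ∀ i w → T (not (inNbar (centre i ∷ []) w)) → block w ≡ i × w ≢ centre i
  ¬inN̄-centre⁻ i w uncovered with block w ≟F i | centre i ≟' w
  ... | _ | yes _ = contradiction _ (T-not⇒¬T uncovered)
  ... | yes w∈i | no i≢w = w∈i , λ w≡i → i≢w (sym w≡i)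
  ... | no w∉i | no _ =
    contradiction (from T-∨ (inj₁ (¬T⇒T-not (other-block-¬adj i (c i) w w∉i)))) (T-not⇒¬T uncovered)

  ¬inN̄-centre⁺ : ∀ i w → block w ≡ i → w ≢ centre i → T (not (inNbar (centre i ∷ []) w))
  ¬inN̄-centre⁺ i w w∈i w≢i with centre i ≟' w
  ... | yes i≡w = contradiction (sym i≡w) w≢i
  ... | no _ = ¬T⇒T-not λ covered →
    T-not⇒¬T (proj₂ (to T-∧ (subst T (∨-identityʳ _) covered))) (centre-adj i w w∈i w≢i)

  counted₂-other-centre : ∀ i t → t ≢ i → ∀ w → T (not (inNbar (centre i ∷ []) w)) →
    T (counted₂ (centre i ∷ []) (centre t) w) × w ≢ centre t
  counted₂-other-centre i t t≢i w uncovered =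
    counted₂⁺ (centre i ∷ []) (centre t) w w≢t (other-block-¬adj t (c t) w λ w∈t → t≢i (trans (sym w∈t) w∈i)) uncovered ,
    w≢t
    where
    w∈i = proj₁ (¬inN̄-centre⁻ i w uncovered)
    w≢t : w ≢ centre t
    w≢t w≡t = t≢i (trans (sym (cong block w≡t)) w∈i)

  score₂≤score₂-other-centre : ∀ i t u → t ≢ i →
    score₂ (centre i ∷ []) u ≤ score₂ (centre i ∷ []) (centre t)
  score₂≤score₂-other-centre i t u t≢i = countIn-exchange _≟'_ (counted₂ D u) (counted₂ D (centre t)) vs'-unique
    (vs'-complete (centre t)) (counted₂-self D (centre t)) exchange
    where
    D = centre i ∷ []
    exchange : ∀ w → T (counted₂ D u w) → w ≢ u → T (counted₂ D (centre t) w) × w ≢ centre t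
    exchange w counted w≢u with counted₂⁻ D u w counted
    ... | inj₁ w≡u = contradiction w≡u w≢u
    ... | inj₂ (_ , uncovered) = counted₂-other-centre i t t≢i w uncovered

  best₂-single-block : (∀ a b → a ≡ b) → ∀ i u → Best₂ (centre i ∷ []) u →
    GlobalDominating (u ∷ centre i ∷ [])
  best₂-single-block one-block i u (u∉D , u-max , _) = (u , here refl) , dominating , dominatingC
    where
    D = centre i ∷ []
    g∉D : g i ∉ D
    g∉D (here ())
    g-counts-all : ∀ w → w ≢ centre i → T (counted₂ D (g i) w)
    g-counts-all w w≢i = by-cases (w ≟' g i)
      where
      by-cases : Dec (w ≡ g i) → T (counted₂ D (g i) w)
      by-cases (yes refl) = counted₂-self D (g i)
      by-cases (no w≢g) = counted₂⁺ D (g i) w w≢g ¬adj (¬inN̄-centre⁺ i w (one-block _ _) w≢i)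
        where
        ¬adj : ¬ T (adj' (g i) w)
        ¬adj adj with g-neighbours i w adj
        ... | inj₁ (b , refl , _) = w≢g (cong g (one-block b i))
        ... | inj₂ w≡i = w≢i w≡i
    only-centre-adj : ∀ w → w ≢ u → w ≢ centre i → ¬ T (adj' u w)
    only-centre-adj w w≢u w≢i adj = <⇒≱ fewer (u-max (g i) g∉D)
      where
      covered : ∀ x → T (counted₂ D u x) → T (counted₂ D (g i) x)
      covered x counted with counted₂⁻ D u x counted
      ... | inj₁ refl = g-counts-all u λ u≡i → u∉D (here u≡i)
      ... | inj₂ (_ , uncovered) = g-counts-all x (proj₂ (¬inN̄-centre⁻ i x uncovered))
      not-counted : ¬ T (counted₂ D u w)
      not-counted counted with counted₂⁻ D u w counted
      ... | inj₁ w≡u = w≢u w≡u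
      ... | inj₂ (¬adj , _) = ¬adj adj
      fewer : score₂ D u < score₂ D (g i)
      fewer = countIn-< (counted₂ D u) (counted₂ D (g i)) vs'-unique covered
        (vs'-complete w) (g-counts-all w w≢i) not-counted
    dominating : Dominating (u ∷ centre i ∷ [])
    dominating x x∉ = centre i , there (here refl) ,
      adjacent-sym (centre i) x (centre-adj i x (one-block _ _) λ x≡i → x∉ (there (here x≡i)))
    dominatingC : DominatingC (u ∷ centre i ∷ [])
    dominatingC x x∉ = u , here refl , (λ x≡u → x∉ (here x≡u)) ,
      nonadjacent-sym u x (only-centre-adj x (λ x≡u → x∉ (here x≡u)) λ x≡i → x∉ (there (here x≡i)))

module H2OnCorona (k : ℕ) (G : SimpleGraph (suc k)) (m : Fin (suc k) → ℕ)
  (H : (i : Fin (suc k)) → SimpleGraph (suc (m i))) (c : (i : Fin (suc k)) → Fin (suc (m i)))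
  (star : ∀ i x → x ≢ c i → adj (H i) (c i) x ≡ true)
  (degree<m : ∀ a t → degree G a < m t) where
  open Corona G m H c
  open Alg G'
  open CoronaGraph G m H c star
  open AlgProperties G' public
  open H2Termination G' vs'-complete (g Fin.zero) public
  open Counting using (unique-⊆⇒length≤)
  open import Data.List.Membership.DecPropositional _≟'_ using (_∈?_)

  Score₁Maximal : List V' → V' → Set
  Score₁Maximal D u = ∀ t → centre t ∉ D → score₁ D (centre t) ≤ score₁ D u

  score₁-maximal⇒centre : ∀ D u t → AllCentres D → centre t ∉ D → Score₁Maximal D u → IsCentre u
  score₁-maximal⇒centre D (inj₁ b) t centres t∉D maximal = contradiction (maximal t t∉D) (<⇒≱ (begin-strict
    score₁ D (g b)        ≤⟨ score₁-g≤ D b ⟩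
    2 + degree G b        <⟨ +-monoʳ-< 2 (degree<m b t) ⟩
    2 + m t               ≤⟨ score₁-centre≥ D t centres t∉D ⟩
    score₁ D (centre t)   ∎))
    where open ≤-Reasoning
  score₁-maximal⇒centre D (inj₂ (l , x)) t centres t∉D maximal = leaf-or-centre (x ≟F c l)
    where
    open ≤-Reasoning
    leaf-or-centre : Dec (x ≡ c l) → IsCentre (h l x)
    leaf-or-centre (yes refl) = l , refl
    leaf-or-centre (no x≢c) = leaf-loses (centre l ∈? D)
      where
      leaf-loses : Dec (centre l ∈ D) → IsCentre (h l x)
      leaf-loses (yes l∈D) = contradiction (maximal t t∉D) (<⇒≱ (begin-strict
        score₁ D (h l x)      ≤⟨ score₁-leaf≤1 D l x x≢c l∈D ⟩
        1                     <⟨ s≤s (s≤s z≤n) ⟩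
        2 + m t               ≤⟨ score₁-centre≥ D t centres t∉D ⟩
        score₁ D (centre t)   ∎))
      leaf-loses (no l∉D) = contradiction (maximal l l∉D) (<⇒≱ (begin-strict
        score₁ D (h l x)      ≤⟨ score₁-leaf≤ D l x x≢c ⟩
        1 + m l               <⟨ n<1+n _ ⟩
        2 + m l               ≤⟨ score₁-centre≥ D l centres l∉D ⟩
        score₁ D (centre l)   ∎))

  allCentres∈⇒dominating : ∀ D → (∀ t → centre t ∈ D) → Dominating D
  allCentres∈⇒dominating D all x x∉D = centre (block x) , all (block x) ,
    adjacent-sym (centre (block x)) x (centre-adj (block x) x refl λ x≡centre → x∉D (subst (_∈ D) (sym x≡centre) (all (block x))))

  uncovered-centre : ∀ D → ¬ Dominating D → Σ (Fin (suc k)) λ t → centre t ∉ D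
  uncovered-centre D ¬dom =
    ¬∀⟶∃¬ (suc k) (λ t → centre t ∈ D) (λ t → centre t ∈? D) λ all → ¬dom (allCentres∈⇒dominating D all)

  best₁-centre : ∀ {D v} → AllCentres D → ¬ Dominating D → Best₁ D v → IsCentre v
  best₁-centre {D} {v} centres ¬dom (_ , v-max , _) =
    let (t , t∉D) = uncovered-centre D ¬dom
    in score₁-maximal⇒centre D v t centres t∉D λ s s∉D → v-max (centre s) s∉D

  -- Every centre outside D ties with u on score₂, so the tie-break makes u score₁-maximal.
  best₂-centre : ∀ {i j u} → j ≢ i → Best₂ (centre i ∷ []) u → IsCentre u
  best₂-centre {i} {j} {u} j≢i (_ , u-max , tie) = score₁-maximal⇒centre D u j only-centre j∉D maximal
    where
    D = centre i ∷ []
    only-centre : AllCentres D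
    only-centre (here refl) = i , refl
    j∉D : centre j ∉ D
    j∉D (here j≡i) = j≢i (cong block j≡i)
    maximal : Score₁Maximal D u
    maximal t t∉D = tie (centre t) t∉D (≤-antisym (u-max (centre t) t∉D) (score₂≤score₂-other-centre i t u t≢i))
      where
      t≢i : t ≢ i
      t≢i refl = t∉D (here refl)

  TwoCentres : List V' → Set
  TwoCentres D = Σ (Fin (suc k)) λ i → Σ (Fin (suc k)) λ j → i ≢ j × centre i ∈ D × centre j ∈ D

  co-dominated-by-far-centre : ∀ {D l} x → x ∉ D → centre l ∈ D → block x ≢ l →
    Σ V' λ y → y ∈ D × x ≢ y × adj' x y ≡ false
  co-dominated-by-far-centre {D} {l} x x∉D l∈D x∉l =
    centre l , l∈D , (λ x≡l → x∉D (subst (_∈ D) (sym x≡l) l∈D)) , nonadjacent-sym (centre l) x (other-block-¬adj l (c l) x x∉l)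

  twoCentres⇒dominatingC : ∀ {D} → TwoCentres D → DominatingC D
  twoCentres⇒dominatingC (i , j , i≢j , i∈D , j∈D) x x∉D with block x ≟F i
  ... | no x∉i = co-dominated-by-far-centre x x∉D i∈D x∉i
  ... | yes x∈i = co-dominated-by-far-centre x x∉D j∈D λ x∈j → i≢j (trans (sym x∈i) x∈j)

  CentresInvariant : List V' → Set
  CentresInvariant D = AllCentres D × TwoCentres D

  twoCentres-∷ : ∀ {D v} → TwoCentres D → TwoCentres (v ∷ D)
  twoCentres-∷ (i , j , i≢j , i∈D , j∈D) = i , j , i≢j , there i∈D , there j∈D

  iteration-preserves-invariant : ∀ {D D₁ D₂} → ¬ GlobalDominating D → Step₁ D D₁ → Step₂ D₁ D₂ →
    CentresInvariant D → CentresInvariant D₂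
  iteration-preserves-invariant ¬gd (skip dom) _ (_ , two@(i , _ , _ , i∈D , _)) =
    contradiction ((centre i , i∈D) , dom , twoCentres⇒dominatingC two) ¬gd
  iteration-preserves-invariant _ (pick ¬dom best) (skip _) (centres , two) =
    (λ { (here refl) → best₁-centre centres ¬dom best ; (there x∈D) → centres x∈D }) , twoCentres-∷ two
  iteration-preserves-invariant _ (pick _ _) (pick ¬domC _) (_ , two) =
    contradiction (twoCentres⇒dominatingC (twoCentres-∷ two)) ¬domC

  ¬dominating-[] : ¬ Dominating []
  ¬dominating-[] dom with dom (g Fin.zero) (λ ())
  ... | _ , () , _

  ¬dominatingC-single : ∀ i → ¬ DominatingC (centre i ∷ [])
  ¬dominatingC-single i domC with domC (g i) (λ { (here ()) })
  ... | _ , here refl , _ , g≁i = subst T g≁i (centre-adj i (g i) refl λ ())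

  first-iteration : ∀ {D₁ D₂} → Step₁ [] D₁ → Step₂ D₁ D₂ →
    Σ (Fin (suc k)) λ i → Σ V' λ u → D₂ ≡ u ∷ centre i ∷ [] × Best₂ (centre i ∷ []) u
  first-iteration (skip dom) _ = contradiction dom ¬dominating-[]
  first-iteration (pick ¬dom best) s₂ with best₁-centre (λ ()) ¬dom best
  ... | i , refl with s₂
  ...   | skip domC = contradiction domC (¬dominatingC-single i)
  ...   | pick _ best-u = i , _ , refl , best-u

  run-allCentres : (∀ i → Σ (Fin (suc k)) (_≢ i)) → ∀ {F} → H2Run [] F → AllCentres F
  run-allCentres other (stop ((_ , ()) , _))
  run-allCentres other (iter _ s₁ s₂ run) with first-iteration s₁ s₂
  ... | i , u , refl , best-u with best₂-centre (proj₂ (other i)) best-u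
  ...   | l , refl = proj₁ (run-invariant CentresInvariant iteration-preserves-invariant run
                                (centres , l , i , l≢i , here refl , there (here refl)))
    where
    l≢i : l ≢ i
    l≢i refl = proj₁ best-u (here refl)
    centres : AllCentres (centre l ∷ centre i ∷ [])
    centres (here refl) = l , refl
    centres (there (here refl)) = i , refl

  run-length-single-block : (∀ (a b : Fin (suc k)) → a ≡ b) → ∀ {F} → H2Run [] F → length F ≡ 2
  run-length-single-block one (stop ((_ , ()) , _))
  run-length-single-block one (iter _ s₁ s₂ run) with first-iteration s₁ s₂
  ... | i , u , refl , best-u = cong length (run-stops (best₂-single-block one i u best-u) run)

  leaf : ∀ i → Σ (Fin (suc (m i))) (_≢ c i)
  leaf i with m i | c i | degree<m i i
  ... | zero | _ | ()
  ... | suc _ | Fin.zero | _ = Fin.suc Fin.zero , λ ()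
  ... | suc _ | Fin.suc _ | _ = Fin.zero , λ ()

  dominating-meets-block : ∀ {S} → Dominating S → ∀ i → Σ V' λ s → s ∈ S × block s ≡ i
  dominating-meets-block {S} dom i with leaf i
  ... | x , x≢c with h i x ∈? S
  ...   | yes x∈S = h i x , x∈S , refl
  ...   | no x∉S with dom (h i x) x∉S
  ...     | s , s∈S , adj with leaf-neighbours i x s x≢c (from T-≡ adj)
  ...       | _ , refl = s , s∈S , refl

  dominating-length≥ : ∀ {S} → Dominating S → suc k ≤ length S
  dominating-length≥ {S} dom = subst (_≤ length S) (length-map-allFin representative)
    (unique-⊆⇒length≤ (Unique.map⁺ representative-injective (Unique.allFin⁺ (suc k))) representatives⊆S)
    where
    representative : Fin (suc k) → V'
    representative i = proj₁ (dominating-meets-block dom i)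
    representative-injective : ∀ {i j} → representative i ≡ representative j → i ≡ j
    representative-injective {i} {j} eq = trans (sym (proj₂ (proj₂ (dominating-meets-block dom i))))
      (trans (cong block eq) (proj₂ (proj₂ (dominating-meets-block dom j))))
    representatives⊆S : map representative (allFin (suc k)) ⊆ S
    representatives⊆S x∈ with ∈-map⁻ representative x∈
    ... | i , _ , refl = proj₁ (proj₂ (dominating-meets-block dom i))

  allCentres-length≤ : ∀ {E} → Unique E → AllCentres E → length E ≤ suc k
  allCentres-length≤ {E} uE centres = subst (length E ≤_) (length-map-allFin centre)
    (unique-⊆⇒length≤ uE λ x∈E → case (centres x∈E))
    where
    case : ∀ {x} → IsCentre x → x ∈ map centre (allFin (suc k))
    case (l , refl) = ∈-map⁺ centre (∈-allFin l)

  h2-minimum : ∀ {E} → H2Run [] E → ∀ S → GlobalDominating S → length E ≤ length S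
  h2-minimum run S gd@(_ , dom , _) with singleton-or-other k
  ... | inj₁ one = subst (_≤ length S) (sym (run-length-single-block one run))
                     (globalDominating-length≥2 {g Fin.zero} {centre Fin.zero} (λ ()) gd)
  ... | inj₂ other = ≤-trans (allCentres-length≤ (run-unique run []) (run-allCentres other run)) (dominating-length≥ dom)


theorem9 : (k : ℕ) (G : SimpleGraph (suc k)) → Connected G →
  (m : Fin (suc k) → ℕ) (H : (i : Fin (suc k)) → SimpleGraph (suc (m i))) →
  (∀ i → Connected (H i)) →
  (c : (i : Fin (suc k)) → Fin (suc (m i))) →
  (∀ i (x : Fin (suc (m i))) → ¬ x ≡ c i → adj (H i) (c i) x ≡ true) →
  (∀ i j → i ≤F j → m j ≤ m i) →
  maxDegree G < m (fromℕ k) →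
  let open Alg (Corona.G' G m H c) in
  (Σ (List (Corona.V' G m H c)) λ E → H2Run [] E) ×
  (∀ E → H2Run [] E →
    GlobalDominating E × Unique E ×
    (∀ S → Unique S → GlobalDominating S → length E ≤ length S))
theorem9 k G _ m H _ c star sorted Δ<m =
  run-exists , λ E run → run-globalDominating run , run-unique run [] , λ S _ → h2-minimum run S
  where
  degree<m : ∀ a t → degree G a < m t
  degree<m a t = begin-strict
    degree G a     ≤⟨ ∈⇒≤foldr-⊔ (degree G) (allFin (suc k)) (∈-allFin a) ⟩
    maxDegree G    <⟨ Δ<m ⟩
    m (fromℕ k)    ≤⟨ sorted t (fromℕ k) (≤fromℕ t) ⟩
    m t            ∎
    where open ≤-Reasoning
  open H2OnCorona k G m H c star degree<m
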